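{- Let $h$ and $n$ be integers with $0<h<n$. Then \[ \mathcal{N}_n(h)=n \frac{\varphi(h)}{h} - \varphi(h) - \sum_{d\mid h}\mu(d)\left\{\frac{n}{d}\right\} + \delta_{1h}\ . \]
   Context: For a positive integer $n$, the Farey sequence $F_n$ is the set of irreducible fractions $a/b$ with $0<a/b\leq 1$ and $1\leq b\leq n$ (the fraction $0/1$ is excluded, $1/1$ is included). $\mathcal{N}_n(h)$ denotes the number of fractions in $F_n$ whose (reduced) numerator equals $h$. $\varphi$ is Euler's totient function, $\mu$ the Möbius function, $\{x\}=x-\lfloor x\rfloor$ the fractional part, and $\delta_{1h}$ the Kronecker delta (equal to $1$ if $h=1$ and $0$ otherwise). -}

module Defs where

open import Data.Bool using (Bool; true; false; if_then_else_)
open import Data.Nat as ℕ using (ℕ; zero; suc; _≤?_; _≟_; _≡ᵇ_)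
open import Data.Nat.GCD using (gcd)
open import Data.Nat.Divisibility using (_∣?_)
open import Data.Nat.Primality using (prime?)
open import Data.Integer as ℤ using (ℤ; +_; -[1+_])
open import Data.List using (List; []; _∷_; map; upTo; filter; length; concatMap; foldr)
open import Data.Product using (_×_; _,_; proj₁; proj₂)
open import Relation.Nullary using (does; ¬?)
open import Relation.Nullary.Decidable using (_×-dec_)
open import Data.Rational as ℚ using (ℚ; 0ℚ; 1ℚ; _+_; _-_; _*_; floor)

[1‥_] : ℕ → List ℕ
[1‥ n ] = map suc (upTo n)

-- Farey sequence F_n: reduced fractions a/b with 0 < a/b ≤ 1, 1 ≤ b ≤ n,
-- represented by their (unique) reduced pair (a , b) with 1 ≤ a ≤ b ≤ n, gcd a b = 1.
Farey : ℕ → List (ℕ × ℕ)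
Farey n = filter (λ p → (proj₁ p ≤? proj₂ p) ×-dec (gcd (proj₁ p) (proj₂ p) ≟ 1))
                 (concatMap (λ b → map (λ a → (a , b)) [1‥ n ]) [1‥ n ])

𝒩 : ℕ → ℕ → ℕ
𝒩 n h = length (filter (λ p → proj₁ p ≟ h) (Farey n))

φ : ℕ → ℕ
φ h = length (filter (λ k → gcd k h ≟ 1) [1‥ h ])

squarefree : ℕ → Bool
squarefree d = length (filter (λ p → prime? p ×-dec (p ℕ.* p ∣? d)) [1‥ d ]) ≡ᵇ 0

ω : ℕ → ℕ
ω d = length (filter (λ p → prime? p ×-dec (p ∣? d)) [1‥ d ])

μ : ℕ → ℤ
μ d = if squarefree d then (-[1+ 0 ]) ℤ.^ ω d else + 0

frac : ℚ → ℚ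
frac x = x - ((floor x) ℚ./ 1)

ℕ→ℚ : ℕ → ℚ
ℕ→ℚ k = (+ k) ℚ./ 1

δ₁ : ℕ → ℚ
δ₁ h = if h ≡ᵇ 1 then 1ℚ else 0ℚ

-- Σ_{d ∣ h} μ(d) {n/d}, summing over the divisors d = k+1 (0 ≤ k < h) of h
divisorSum : ℕ → ℕ → ℚ
divisorSum h n =
  foldr _+_ 0ℚ
    (map (λ k → (μ (suc k) ℚ./ 1) * frac ((+ n) ℚ./ suc k))
         (filter (λ k → suc k ∣? h) (upTo h)))

-- For 0 < h < n, 𝒩_n(h) counts the b with h ≤ b ≤ n and gcd(h, b) = 1, while φ(h) counts the
-- b ≤ h coprime to h; together they count every b ≤ n coprime to h once, except b = h, which is
-- coprime to h only when h = 1. So 𝒩_n(h) = C(n) − φ(h) + δ_{1h} with C(N) = #{b ≤ N : gcd(b, h) = 1}.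
-- Möbius inversion, Σ_{d ∣ g} μ(d) = [g = 1] (split the divisors of g at a prime p ∣ g), turns
-- [gcd(b, h) = 1] into Σ_{d ∣ h, d ∣ b} μ(d), whence C(N) = Σ_{d ∣ h} μ(d) ⌊N/d⌋. At N = h this is
-- φ(h) = Σ_{d ∣ h} μ(d) h/d, and at N = n the substitution ⌊n/d⌋ = n/d − {n/d} gives the theorem.

module Submission where

open import Defs

module FiniteSums where

  open import Algebra.Bundles using (CommutativeSemiring; CommutativeRing)
  import Data.Integer.Properties as ℤₚ
  import Data.Rational.Properties as ℚₚ
  open import Data.Bool using (Bool; true; false; if_then_else_)
  open import Data.List using (List; []; _∷_; _++_; map; foldr; filter; concatMap; applyUpTo)
  open import Data.Nat as ℕ using (ℕ; zero; suc; _≤_; _<_; _∸_)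
  import Data.Nat.Properties as ℕ
  open import Function using (_∘_)
  open import Level using (Level)
  open import Relation.Binary.PropositionalEquality as ≡ using (_≡_; _≢_)
  open import Data.List.Properties using (map-applyUpTo)
  open import Relation.Nullary using (does; yes; no)
  open import Relation.Nullary.Decidable using (dec-true; dec-false)
  open import Data.Nat.Divisibility using (_∣_; _∣?_; divides; ∣⇒≤; ∣m+n∣m⇒∣n; n∣m*n)
  open import Relation.Unary using (Pred; Decidable)

  ∣-within-block : ∀ {d e j} → j < d → d ∣ suc (e ℕ.* d ℕ.+ j) → suc j ≡ d
  ∣-within-block {d} {e} {j} j<d d∣ = ℕ.≤-antisym j<d (∣⇒≤ d∣1+j)
    where
    d∣1+j : d ∣ suc j
    d∣1+j = ∣m+n∣m⇒∣n (≡.subst (d ∣_) (≡.sym (ℕ.+-suc (e ℕ.* d) j)) d∣) (n∣m*n e)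

  module Sums {c ℓ} (R : CommutativeSemiring c ℓ) where

    open CommutativeSemiring R
    open import Relation.Binary.Reasoning.Setoid setoid

    ∑ : ℕ → (ℕ → Carrier) → Carrier
    ∑ zero    f = 0#
    ∑ (suc n) f = ∑ n f + f n

    syntax ∑ n (λ k → e) = ∑[ k < n ] e

    𝟙 : Bool → Carrier
    𝟙 b = if b then 1# else 0#

    ∑-cong : ∀ n {f g : ℕ → Carrier} → (∀ k → k < n → f k ≈ g k) → ∑ n f ≈ ∑ n g
    ∑-cong zero    f≈g = refl
    ∑-cong (suc n) f≈g = +-cong (∑-cong n (λ k k<n → f≈g k (ℕ.m<n⇒m<1+n k<n))) (f≈g n ℕ.≤-refl)

    ∑-zero : ∀ n {f : ℕ → Carrier} → (∀ k → k < n → f k ≈ 0#) → ∑ n f ≈ 0#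
    ∑-zero zero    f≈0 = refl
    ∑-zero (suc n) f≈0 = begin
      ∑ n _ + _ ≈⟨ +-cong (∑-zero n (λ k k<n → f≈0 k (ℕ.m<n⇒m<1+n k<n))) (f≈0 n ℕ.≤-refl) ⟩
      0# + 0#   ≈⟨ +-identityˡ 0# ⟩
      0#        ∎

    ∑-suc : ∀ n (f : ℕ → Carrier) → ∑ (suc n) f ≈ f 0 + ∑ n (f ∘ suc)
    ∑-suc zero    f = trans (+-identityˡ (f 0)) (sym (+-identityʳ (f 0)))
    ∑-suc (suc n) f = begin
      ∑ (suc n) f + f (suc n)            ≈⟨ +-congʳ (∑-suc n f) ⟩
      f 0 + ∑ n (f ∘ suc) + f (suc n)    ≈⟨ +-assoc _ _ _ ⟩
      f 0 + ∑ (suc n) (f ∘ suc)          ∎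

    ∑-split : ∀ m n (f : ℕ → Carrier) → ∑ (m ℕ.+ n) f ≈ ∑ m f + ∑[ k < n ] f (m ℕ.+ k)
    ∑-split m zero f rewrite ℕ.+-identityʳ m = sym (+-identityʳ _)
    ∑-split m (suc n) f rewrite ℕ.+-suc m n = begin
      ∑ (m ℕ.+ n) f + f (m ℕ.+ n)                  ≈⟨ +-congʳ (∑-split m n f) ⟩
      ∑ m f + ∑[ k < n ] f (m ℕ.+ k) + f (m ℕ.+ n) ≈⟨ +-assoc _ _ _ ⟩
      ∑ m f + ∑[ k < suc n ] f (m ℕ.+ k)           ∎

    ∑-restrict : ∀ {m n} (f : ℕ → Carrier) → m ≤ n → (∀ k → m ≤ k → k < n → f k ≈ 0#) →
                 ∑ n f ≈ ∑ m f
    ∑-restrict {m} {n} f m≤n f≈0 = begin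
      ∑ n f                              ≡⟨ ≡.cong (λ x → ∑ x f) (≡.sym (ℕ.m+[n∸m]≡n m≤n)) ⟩
      ∑ (m ℕ.+ (n ∸ m)) f                ≈⟨ ∑-split m (n ∸ m) f ⟩
      ∑ m f + ∑[ k < n ∸ m ] f (m ℕ.+ k) ≈⟨ +-congˡ (∑-zero (n ∸ m) tail≈0) ⟩
      ∑ m f + 0#                         ≈⟨ +-identityʳ _ ⟩
      ∑ m f                              ∎
      where
      tail≈0 : ∀ k → k < n ∸ m → f (m ℕ.+ k) ≈ 0#
      tail≈0 k k<n∸m = f≈0 (m ℕ.+ k) (ℕ.m≤m+n m k)
        (≡.subst (m ℕ.+ k <_) (ℕ.m+[n∸m]≡n m≤n) (ℕ.+-monoʳ-< m k<n∸m))

    ∑-single : ∀ n j (f : ℕ → Carrier) → j < n → (∀ k → k < n → k ≢ j → f k ≈ 0#) →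
               ∑ n f ≈ f j
    ∑-single (suc n) j f j<1+n f≈0 with j ℕ.≟ n
    ... | yes ≡.refl = begin
      ∑ j f + f j ≈⟨ +-congʳ (∑-zero j (λ k k<j → f≈0 k (ℕ.m<n⇒m<1+n k<j) (ℕ.<⇒≢ k<j))) ⟩
      0# + f j    ≈⟨ +-identityˡ (f j) ⟩
      f j         ∎
    ... | no j≢n = begin
      ∑ n f + f n ≈⟨ +-congˡ (f≈0 n ℕ.≤-refl (j≢n ∘ ≡.sym)) ⟩
      ∑ n f + 0#  ≈⟨ +-identityʳ _ ⟩
      ∑ n f       ≈⟨ ∑-single n j f (ℕ.≤∧≢⇒< (ℕ.≤-pred j<1+n) j≢n) (λ k k<n → f≈0 k (ℕ.m<n⇒m<1+n k<n)) ⟩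
      f j         ∎

    ∑-distrib-+ : ∀ n (f g : ℕ → Carrier) → ∑[ k < n ] (f k + g k) ≈ ∑ n f + ∑ n g
    ∑-distrib-+ zero    f g = sym (+-identityˡ 0#)
    ∑-distrib-+ (suc n) f g = begin
      ∑[ k < n ] (f k + g k) + (f n + g n) ≈⟨ +-congʳ (∑-distrib-+ n f g) ⟩
      ∑ n f + ∑ n g + (f n + g n)          ≈⟨ interchange-+ (∑ n f) (∑ n g) (f n) (g n) ⟩
      ∑ (suc n) f + ∑ (suc n) g            ∎
      where
      interchange-+ : ∀ a b x y → a + b + (x + y) ≈ a + x + (b + y)
      interchange-+ a b x y = begin
        a + b + (x + y)   ≈⟨ +-assoc a b (x + y) ⟩
        a + (b + (x + y)) ≈⟨ +-congˡ (sym (+-assoc b x y)) ⟩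
        a + (b + x + y)   ≈⟨ +-congˡ (+-congʳ (+-comm b x)) ⟩
        a + (x + b + y)   ≈⟨ +-congˡ (+-assoc x b y) ⟩
        a + (x + (b + y)) ≈⟨ sym (+-assoc a x (b + y)) ⟩
        a + x + (b + y)   ∎

    ∑-comm : ∀ m n (f : ℕ → ℕ → Carrier) →
             ∑[ i < m ] ∑[ j < n ] f i j ≈ ∑[ j < n ] ∑[ i < m ] f i j
    ∑-comm zero    n f = sym (∑-zero n (λ _ _ → refl))
    ∑-comm (suc m) n f = begin
      ∑[ i < m ] ∑[ j < n ] f i j + ∑[ j < n ] f m j ≈⟨ +-congʳ (∑-comm m n f) ⟩
      ∑[ j < n ] ∑[ i < m ] f i j + ∑[ j < n ] f m j ≈⟨ sym (∑-distrib-+ n _ _) ⟩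
      ∑[ j < n ] ∑[ i < suc m ] f i j                ∎

    ∑-distribˡ : ∀ n a (f : ℕ → Carrier) → ∑[ k < n ] (a * f k) ≈ a * ∑ n f
    ∑-distribˡ zero    a f = sym (zeroʳ a)
    ∑-distribˡ (suc n) a f = trans (+-congʳ (∑-distribˡ n a f)) (sym (distribˡ a (∑ n f) (f n)))

    ∑-distribʳ : ∀ n a (f : ℕ → Carrier) → ∑[ k < n ] (f k * a) ≈ ∑ n f * a
    ∑-distribʳ zero    a f = sym (zeroˡ a)
    ∑-distribʳ (suc n) a f = trans (+-congʳ (∑-distribʳ n a f)) (sym (distribʳ a (∑ n f) (f n)))

    ∑-blocks : ∀ m d (f : ℕ → Carrier) → ∑ (m ℕ.* d) f ≈ ∑[ e < m ] ∑[ j < d ] f (e ℕ.* d ℕ.+ j)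
    ∑-blocks zero    d f = refl
    ∑-blocks (suc m) d f = begin
      ∑ (d ℕ.+ m ℕ.* d) f                            ≡⟨ ≡.cong (λ x → ∑ x f) (ℕ.+-comm d (m ℕ.* d)) ⟩
      ∑ (m ℕ.* d ℕ.+ d) f                            ≈⟨ ∑-split (m ℕ.* d) d f ⟩
      ∑ (m ℕ.* d) f + ∑[ j < d ] f (m ℕ.* d ℕ.+ j)   ≈⟨ +-congʳ (∑-blocks m d f) ⟩
      ∑[ e < suc m ] ∑[ j < d ] f (e ℕ.* d ℕ.+ j)    ∎

    ∑-multiples : ∀ m d' (f : ℕ → Carrier) →
                  ∑[ k < m ℕ.* suc d' ] (if does (suc d' ∣? suc k) then f k else 0#) ≈ ∑[ e < m ] f (e ℕ.* suc d' ℕ.+ d')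
    ∑-multiples m d' f = trans (∑-blocks m d _) (∑-cong m (λ e _ → block e))
      where
      d = suc d'
      block : ∀ e → ∑[ j < d ] (if does (d ∣? suc (e ℕ.* d ℕ.+ j)) then f (e ℕ.* d ℕ.+ j) else 0#) ≈ f (e ℕ.* d ℕ.+ d')
      block e = begin
        ∑[ j < d ] (if does (d ∣? suc (e ℕ.* d ℕ.+ j)) then f (e ℕ.* d ℕ.+ j) else 0#)
          ≈⟨ ∑-single d d' _ ℕ.≤-refl (λ j j<d j≢d' →
               reflexive (≡.cong (λ b → if b then f (e ℕ.* d ℕ.+ j) else 0#)
                 (dec-false (d ∣? _) (j≢d' ∘ ℕ.suc-injective ∘ ∣-within-block {e = e} j<d)))) ⟩
        (if does (d ∣? suc (e ℕ.* d ℕ.+ d')) then f (e ℕ.* d ℕ.+ d') else 0#)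
          ≡⟨ ≡.cong (λ b → if b then f (e ℕ.* d ℕ.+ d') else 0#)
               (dec-true (d ∣? _) (divides (suc e) (≡.cong suc (ℕ.+-comm (e ℕ.* d) d')))) ⟩
        f (e ℕ.* d ℕ.+ d') ∎

    sumOf : {A : Set} → (A → Carrier) → List A → Carrier
    sumOf f xs = foldr _+_ 0# (map f xs)

    sumOf-++ : {A : Set} (f : A → Carrier) (xs ys : List A) →
               sumOf f (xs ++ ys) ≈ sumOf f xs + sumOf f ys
    sumOf-++ f []       ys = sym (+-identityˡ _)
    sumOf-++ f (x ∷ xs) ys = trans (+-congˡ (sumOf-++ f xs ys)) (sym (+-assoc _ _ _))

    sumOf-concatMap : {A B : Set} (f : B → Carrier) (g : A → List B) (xs : List A) →
                      sumOf f (concatMap g xs) ≈ sumOf (sumOf f ∘ g) xs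
    sumOf-concatMap f g []       = refl
    sumOf-concatMap f g (x ∷ xs) = trans (sumOf-++ f (g x) (concatMap g xs)) (+-congˡ (sumOf-concatMap f g xs))

    sumOf-filter : {A : Set} {P : Pred A Level.zero} (P? : Decidable P) (f : A → Carrier) (xs : List A) →
                   sumOf f (filter P? xs) ≈ sumOf (λ x → if does (P? x) then f x else 0#) xs
    sumOf-filter P? f []       = refl
    sumOf-filter P? f (x ∷ xs) with does (P? x)
    ... | true  = +-congˡ (sumOf-filter P? f xs)
    ... | false = trans (sumOf-filter P? f xs) (sym (+-identityˡ _))

    sumOf-applyUpTo : {A : Set} (f : A → Carrier) (g : ℕ → A) (n : ℕ) → sumOf f (applyUpTo g n) ≈ ∑[ k < n ] f (g k)
    sumOf-applyUpTo f g zero    = refl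
    sumOf-applyUpTo f g (suc n) = trans (+-congˡ (sumOf-applyUpTo f (g ∘ suc) n)) (sym (∑-suc n (f ∘ g)))

    sumOf-[1‥] : (f : ℕ → Carrier) (n : ℕ) → sumOf f [1‥ n ] ≈ ∑[ k < n ] f (suc k)
    sumOf-[1‥] f n rewrite map-applyUpTo (λ k → k) suc n = sumOf-applyUpTo f suc n

  module ℕΣ = Sums ℕ.+-*-commutativeSemiring
  module ℤΣ = Sums ℤₚ.+-*-commutativeSemiring
  module ℚΣ = Sums (CommutativeRing.commutativeSemiring ℚₚ.+-*-commutativeRing)

module FareyCount where

  open import Data.Bool using (true; false; _∧_; if_then_else_)
  open import Data.List using (List; []; _∷_; map; filter; length; foldr; concatMap)
  open import Data.List.Properties using (map-∘)
  open import Data.Nat as ℕ using (ℕ; suc; _+_; _∸_; _<_; _≤?_; _≟_; _≡ᵇ_; s≤s)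
  import Data.Nat.Properties as ℕₚ
  open import Data.Nat.GCD using (gcd; gcd-comm; gcd[m,n]∣m; gcd-greatest)
  open import Data.Nat.Divisibility using (∣-antisym; ∣-refl)
  open import Data.Product using (_×_; _,_; proj₁; proj₂)
  open import Function using (_∘_)
  open import Level using (0ℓ)
  open import Relation.Binary.PropositionalEquality
  open import Relation.Nullary using (does)
  open import Relation.Nullary.Decidable using (dec-true; dec-false; _×-dec_)
  open import Relation.Unary using (Pred; Decidable)
  open FiniteSums

  open ℕΣ using (𝟙; sumOf)

  length≡sumOf-1 : {A : Set} (xs : List A) → length xs ≡ sumOf (λ _ → 1) xs
  length≡sumOf-1 []       = refl
  length≡sumOf-1 (x ∷ xs) = cong suc (length≡sumOf-1 xs)

  length-filter≡sumOf : {A : Set} {P : Pred A 0ℓ} (P? : Decidable P) (xs : List A) →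
                  length (filter P? xs) ≡ sumOf (λ x → 𝟙 (does (P? x))) xs
  length-filter≡sumOf P? xs = trans (length≡sumOf-1 (filter P? xs)) (ℕΣ.sumOf-filter P? (λ _ → 1) xs)

  coprimeCount : ℕ → ℕ → ℕ
  coprimeCount h N = ℕΣ.∑[ b < N ] 𝟙 (does (gcd (suc b) h ≟ 1))

  φ≡coprimeCount : ∀ h → φ h ≡ coprimeCount h h
  φ≡coprimeCount h = trans (length-filter≡sumOf (λ k → gcd k h ≟ 1) [1‥ h ]) (ℕΣ.sumOf-[1‥] _ h)

  𝒩≡∑ : ∀ {n h'} → h' < n →
        𝒩 n (suc h') ≡ ℕΣ.∑[ b < n ] 𝟙 (does (suc h' ≤? suc b) ∧ does (gcd (suc h') (suc b) ≟ 1))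
  𝒩≡∑ {n} {h'} h'<n = begin
    length (filter Q? (filter P? L))                    ≡⟨ length-filter≡sumOf Q? (filter P? L) ⟩
    sumOf (λ x → 𝟙 (does (Q? x))) (filter P? L)         ≡⟨ ℕΣ.sumOf-filter P? _ L ⟩
    sumOf F L                                           ≡⟨ ℕΣ.sumOf-concatMap F row [1‥ n ] ⟩
    sumOf (λ b → sumOf F (row b)) [1‥ n ]               ≡⟨ ℕΣ.sumOf-[1‥] _ n ⟩
    ℕΣ.∑[ b < n ] sumOf F (row (suc b))                 ≡⟨ ℕΣ.∑-cong n (λ b _ → column b) ⟩
    ℕΣ.∑[ b < n ] 𝟙 (does (P? (h , suc b)))            ∎
    where
    open ≡-Reasoning
    h = suc h'
    P? = λ (x : ℕ × ℕ) → (proj₁ x ≤? proj₂ x) ×-dec (gcd (proj₁ x) (proj₂ x) ≟ 1)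
    Q? = λ (x : ℕ × ℕ) → proj₁ x ≟ h
    row = λ b → map (λ a → (a , b)) [1‥ n ]
    L = concatMap row [1‥ n ]
    F = λ x → if does (P? x) then 𝟙 (does (Q? x)) else 0
    F-off : ∀ p → (if p then 𝟙 false else 0) ≡ 0
    F-off true  = refl
    F-off false = refl
    F-on : ∀ p → (if p then 𝟙 true else 0) ≡ 𝟙 p
    F-on true  = refl
    F-on false = refl
    column : ∀ b → sumOf F (row (suc b)) ≡ 𝟙 (does (P? (h , suc b)))
    column b = begin
      sumOf F (row (suc b))                      ≡⟨ cong (foldr ℕ._+_ 0) (sym (map-∘ [1‥ n ])) ⟩
      sumOf (λ a → F (a , suc b)) [1‥ n ]        ≡⟨ ℕΣ.sumOf-[1‥] _ n ⟩
      ℕΣ.∑[ a < n ] F (suc a , suc b)            ≡⟨ ℕΣ.∑-single n h' _ h'<n off ⟩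
      F (h , suc b)                              ≡⟨ cong (λ q → if does (P? (h , suc b)) then 𝟙 q else 0) (dec-true (h ≟ h) refl) ⟩
      (if does (P? (h , suc b)) then 𝟙 true else 0) ≡⟨ F-on _ ⟩
      𝟙 (does (P? (h , suc b)))                  ∎
      where
      off : ∀ a → a < n → a ≢ h' → F (suc a , suc b) ≡ 0
      off a _ a≢h' rewrite dec-false (suc a ≟ h) (a≢h' ∘ ℕₚ.suc-injective) = F-off _

  gcd[n,n]≡n : ∀ n → gcd n n ≡ n
  gcd[n,n]≡n n = ∣-antisym (gcd[m,n]∣m n n) (gcd-greatest ∣-refl ∣-refl)

  𝒩+coprimeCount : ∀ {n h'} → h' < n → 𝒩 n (suc h') + coprimeCount (suc h') h' ≡ coprimeCount (suc h') n
  𝒩+coprimeCount {n} {h'} h'<n = begin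
    𝒩 n h + ℕΣ.∑ h' c                                        ≡⟨ cong (_+ ℕΣ.∑ h' c) (𝒩≡∑ h'<n) ⟩
    ℕΣ.∑ n t + ℕΣ.∑ h' c                                     ≡⟨ cong (λ x → ℕΣ.∑ x t + ℕΣ.∑ h' c) (sym h'+m≡n) ⟩
    ℕΣ.∑ (h' + m) t + ℕΣ.∑ h' c                              ≡⟨ cong (_+ ℕΣ.∑ h' c) (ℕΣ.∑-split h' m t) ⟩
    ℕΣ.∑ h' t + ℕΣ.∑[ k < m ] t (h' + k) + ℕΣ.∑ h' c         ≡⟨ cong₂ (λ x y → x + y + ℕΣ.∑ h' c) head tail ⟩
    0 + ℕΣ.∑[ k < m ] c (h' + k) + ℕΣ.∑ h' c                 ≡⟨ ℕₚ.+-comm (ℕΣ.∑[ k < m ] c (h' + k)) _ ⟩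
    ℕΣ.∑ h' c + ℕΣ.∑[ k < m ] c (h' + k)                     ≡⟨ ℕΣ.∑-split h' m c ⟨
    ℕΣ.∑ (h' + m) c                                          ≡⟨ cong (λ x → ℕΣ.∑ x c) h'+m≡n ⟩
    ℕΣ.∑ n c                                                 ∎
    where
    open ≡-Reasoning
    h = suc h'
    m = n ∸ h'
    h'+m≡n : h' + m ≡ n
    h'+m≡n = ℕₚ.m+[n∸m]≡n (ℕₚ.<⇒≤ h'<n)
    c = λ b → 𝟙 (does (gcd (suc b) h ≟ 1))
    t = λ b → 𝟙 (does (h ≤? suc b) ∧ does (gcd h (suc b) ≟ 1))
    head : ℕΣ.∑ h' t ≡ 0
    head = ℕΣ.∑-zero h' λ b b<h' →
      cong (λ p → 𝟙 (p ∧ does (gcd h (suc b) ≟ 1))) (dec-false (h ≤? suc b) (ℕₚ.<⇒≱ (s≤s b<h')))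
    tail : ℕΣ.∑[ k < m ] t (h' + k) ≡ ℕΣ.∑[ k < m ] c (h' + k)
    tail = ℕΣ.∑-cong m λ k _ → trans
      (cong (λ p → 𝟙 (p ∧ does (gcd h (suc (h' + k)) ≟ 1))) (dec-true (h ≤? suc (h' + k)) (s≤s (ℕₚ.m≤m+n h' k))))
      (cong (λ g → 𝟙 (does (g ≟ 1))) (gcd-comm h (suc (h' + k))))

  𝒩+φ : ∀ {n h'} → h' < n → 𝒩 n (suc h') + φ (suc h') ≡ coprimeCount (suc h') n + 𝟙 (suc h' ≡ᵇ 1)
  𝒩+φ {n} {h'} h'<n = begin
    𝒩 n h + φ h
      ≡⟨ cong (𝒩 n h +_) (φ≡coprimeCount h) ⟩
    𝒩 n h + (coprimeCount h h' + 𝟙 (does (gcd h h ≟ 1)))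
      ≡⟨ cong (λ g → 𝒩 n h + (coprimeCount h h' + 𝟙 (does (g ≟ 1)))) (gcd[n,n]≡n h) ⟩
    𝒩 n h + (coprimeCount h h' + 𝟙 (h ≡ᵇ 1))
      ≡⟨ ℕₚ.+-assoc (𝒩 n h) _ _ ⟨
    𝒩 n h + coprimeCount h h' + 𝟙 (h ≡ᵇ 1)
      ≡⟨ cong (_+ 𝟙 (h ≡ᵇ 1)) (𝒩+coprimeCount h'<n) ⟩
    coprimeCount h n + 𝟙 (h ≡ᵇ 1) ∎
    where
    open ≡-Reasoning
    h = suc h'

module Möbius where

  open import Data.Bool using (true; false; _∧_; if_then_else_)
  open import Data.Bool.Properties using (∧-zeroʳ)
  open import Data.Empty using (⊥-elim)
  open import Data.Integer as ℤ using (ℤ; +_; -[1+_]; 0ℤ; -1ℤ)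
  import Data.Integer.Properties as ℤₚ
  open import Data.Nat as ℕ using (ℕ; zero; suc; _+_; _*_; _≤_; _<_; _≟_; _≡ᵇ_; NonZero; s≤s; z≤n)
  import Data.Nat.Properties as ℕₚ
  open import Data.Nat.Coprimality using (Coprime; coprime-divisor) renaming (sym to coprime-sym)
  open import Data.Nat.Divisibility
  open import Data.Nat.Primality using (Prime; prime?; euclidsLemma; prime⇒irreducible; prime⇒nonTrivial; prime⇒nonZero)
  open import Data.Product using (_×_; _,_; ∃-syntax)
  open import Data.List using ([]; _∷_)
  open import Data.List.Relation.Unary.All using (_∷_)
  open import Data.Nat.ListAction using (product)
  open import Data.Nat.Primality.Factorisation using (factorise)
  open import Data.Sum using (inj₁; inj₂)
  open import Function using (_∘_; _⇔_; mk⇔)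
  open import Relation.Binary.PropositionalEquality
  open import Relation.Nullary using (Dec; does; yes; no; ¬_)
  open import Relation.Nullary.Decidable using (dec-true; dec-false; does-⇔; _×-dec_)
  open FiniteSums
  open FareyCount

  open ℕΣ using (𝟙)

  prime>1 : ∀ {p} → Prime p → 1 < p
  prime>1 {p} p-prime = ℕ.nonTrivial⇒n>1 p {{prime⇒nonTrivial p-prime}}

  prime∣prime⇒≡ : ∀ {p q} → Prime p → Prime q → q ∣ p → q ≡ p
  prime∣prime⇒≡ p-prime q-prime q∣p with prime⇒irreducible p-prime q∣p
  ... | inj₁ refl = ⊥-elim (ℕₚ.<-irrefl refl (prime>1 q-prime))
  ... | inj₂ q≡p  = q≡p

  prime∤⇒coprime : ∀ {p n} → Prime p → ¬ p ∣ n → Coprime p n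
  prime∤⇒coprime p-prime p∤n (d∣p , d∣n) with prime⇒irreducible p-prime d∣p
  ... | inj₁ d≡1 = d≡1
  ... | inj₂ refl = ⊥-elim (p∤n d∣n)

  prime∣*⇒∣ : ∀ {p q} e → Prime p → Prime q → q ≢ p → q ∣ p * e → q ∣ e
  prime∣*⇒∣ {p} e p-prime q-prime q≢p q∣pe with euclidsLemma p e q-prime q∣pe
  ... | inj₁ q∣p = ⊥-elim (q≢p (prime∣prime⇒≡ p-prime q-prime q∣p))
  ... | inj₂ q∣e = q∣e

  square∣*⇒∣ : ∀ {p q} e → Prime p → ¬ p ∣ e → Prime q → q * q ∣ p * e → q * q ∣ e
  square∣*⇒∣ {p} {q} e p-prime p∤e q-prime qq∣pe with q ≟ p
  ... | yes refl = ⊥-elim (p∤e (*-cancelˡ-∣ p {{prime⇒nonZero p-prime}} qq∣pe))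
  ... | no q≢p = coprime-divisor (coprime-sym (prime∤⇒coprime p-prime p∤qq)) qq∣pe
    where
    p∤qq : ¬ p ∣ q * q
    p∤qq p∣qq with euclidsLemma q q p-prime p∣qq
    ... | inj₁ p∣q = q≢p (sym (prime∣prime⇒≡ q-prime p-prime p∣q))
    ... | inj₂ p∣q = q≢p (sym (prime∣prime⇒≡ q-prime p-prime p∣q))

  term≤∑ : ∀ n j (f : ℕ → ℕ) → j < n → f j ≤ ℕΣ.∑ n f
  term≤∑ (suc n) j f j<1+n with j ≟ n
  ... | yes refl = ℕₚ.m≤n+m (f j) (ℕΣ.∑ j f)
  ... | no j≢n   = ℕₚ.≤-trans (term≤∑ n j f (ℕₚ.≤∧≢⇒< (ℕₚ.≤-pred j<1+n) j≢n)) (ℕₚ.m≤m+n (ℕΣ.∑ n f) (f n))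

  primeSquareDivisorCount primeDivisorCount : ℕ → ℕ
  primeSquareDivisorCount d = ℕΣ.∑[ k < d ] 𝟙 (does (prime? (suc k)) ∧ does (suc k * suc k ∣? d))
  primeDivisorCount  d = ℕΣ.∑[ k < d ] 𝟙 (does (prime? (suc k)) ∧ does (suc k ∣? d))

  μ-unfold : ∀ d → μ d ≡ (if primeSquareDivisorCount d ≡ᵇ 0 then -[1+ 0 ] ℤ.^ primeDivisorCount d else + 0)
  μ-unfold d
    rewrite length-filter≡sumOf (λ q → prime? q ×-dec (q * q ∣? d)) [1‥ d ]
          | ℕΣ.sumOf-[1‥] (λ q → 𝟙 (does (prime? q) ∧ does (q * q ∣? d))) d
          | length-filter≡sumOf (λ q → prime? q ×-dec (q ∣? d)) [1‥ d ]
          | ℕΣ.sumOf-[1‥] (λ q → 𝟙 (does (prime? q) ∧ does (q ∣? d))) d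
          = refl

  module _ {p'} (p-prime : Prime (suc p')) (e : ℕ) .{{_ : NonZero e}} where

    private
      p = suc p'

      e≤pe : e ≤ p * e
      e≤pe = ℕₚ.m≤n*m e p

      p'<pe : p' < p * e
      p'<pe = ℕₚ.m≤m*n p e

    μ-*-∣ : p ∣ e → μ (p * e) ≡ 0ℤ
    μ-*-∣ p∣e = trans (μ-unfold (p * e))
      (cong (λ s → if s ≡ᵇ 0 then -[1+ 0 ] ℤ.^ primeDivisorCount (p * e) else + 0) (sym (ℕₚ.m+[n∸m]≡n squares≥1)))
      where
      squares≥1 : 1 ≤ primeSquareDivisorCount (p * e)
      squares≥1 = subst (_≤ primeSquareDivisorCount (p * e))
        (cong₂ (λ x y → 𝟙 (x ∧ y)) (dec-true (prime? p) p-prime) (dec-true (p * p ∣? p * e) (*-monoʳ-∣ p p∣e)))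
        (term≤∑ (p * e) p' _ p'<pe)

    primeSquareDivisorCount-∤ : ¬ p ∣ e → primeSquareDivisorCount (p * e) ≡ primeSquareDivisorCount e
    primeSquareDivisorCount-∤ p∤e = trans (ℕΣ.∑-cong (p * e) (λ k _ → term k))
      (ℕΣ.∑-restrict _ e≤pe (λ k e≤k _ → beyond k e≤k))
      where
      beyond : ∀ k → e ≤ k → 𝟙 (does (prime? (suc k)) ∧ does (suc k * suc k ∣? e)) ≡ 0
      beyond k e≤k = trans
        (cong (λ b → 𝟙 (does (prime? (suc k)) ∧ b))
              (dec-false (suc k * suc k ∣? e) (>⇒∤ (ℕₚ.<-≤-trans (s≤s e≤k) (ℕₚ.m≤m*n (suc k) (suc k))))))
        (cong 𝟙 (∧-zeroʳ _))
      term : ∀ k → 𝟙 (does (prime? (suc k)) ∧ does (suc k * suc k ∣? p * e))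
                 ≡ 𝟙 (does (prime? (suc k)) ∧ does (suc k * suc k ∣? e))
      term k with prime? (suc k)
      ... | no _        = refl
      ... | yes q-prime = cong 𝟙 (does-⇔ (mk⇔ (square∣*⇒∣ e p-prime p∤e q-prime) (λ qq∣e → ∣-trans qq∣e (n∣m*n p)))
                                         (suc k * suc k ∣? p * e) (suc k * suc k ∣? e))

    primeDivisorCount-∤ : ¬ p ∣ e → primeDivisorCount (p * e) ≡ suc (primeDivisorCount e)
    primeDivisorCount-∤ p∤e = begin
      primeDivisorCount (p * e)
        ≡⟨ ℕΣ.∑-cong (p * e) (λ k _ → term k) ⟩
      ℕΣ.∑[ k < p * e ] (t e k + 𝟙 (does (k ≟ p')))
        ≡⟨ ℕΣ.∑-distrib-+ (p * e) (t e) _ ⟩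
      ℕΣ.∑ (p * e) (t e) + ℕΣ.∑[ k < p * e ] 𝟙 (does (k ≟ p'))
        ≡⟨ cong₂ _+_ (ℕΣ.∑-restrict (t e) e≤pe (λ k e≤k _ → beyond k e≤k))
                     (ℕΣ.∑-single (p * e) p' _ p'<pe (λ k _ k≢p' → cong 𝟙 (dec-false (k ≟ p') k≢p'))) ⟩
      primeDivisorCount e + 𝟙 (does (p' ≟ p'))
        ≡⟨ cong (λ b → primeDivisorCount e + 𝟙 b) (dec-true (p' ≟ p') refl) ⟩
      primeDivisorCount e + 1
        ≡⟨ ℕₚ.+-comm _ 1 ⟩
      suc (primeDivisorCount e) ∎
      where
      open ≡-Reasoning
      t : ℕ → ℕ → ℕ
      t d k = 𝟙 (does (prime? (suc k)) ∧ does (suc k ∣? d))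
      beyond : ∀ k → e ≤ k → t e k ≡ 0
      beyond k e≤k = trans (cong (λ b → 𝟙 (does (prime? (suc k)) ∧ b)) (dec-false (suc k ∣? e) (>⇒∤ (s≤s e≤k))))
                           (cong 𝟙 (∧-zeroʳ _))
      term : ∀ k → t (p * e) k ≡ t e k + 𝟙 (does (k ≟ p'))
      term k with k ≟ p'
      ... | yes refl
        rewrite dec-true (prime? p) p-prime | dec-true (p ∣? p * e) (m∣m*n e) | dec-false (p ∣? e) p∤e
        = cong 𝟙 (sym (dec-true (k ≟ k) refl))
      ... | no k≢p' rewrite dec-false (k ≟ p') k≢p' with prime? (suc k)
      ...   | no _        = refl
      ...   | yes q-prime = trans
        (cong 𝟙 (does-⇔ (mk⇔ (prime∣*⇒∣ e p-prime q-prime (k≢p' ∘ ℕₚ.suc-injective)) (λ q∣e → ∣-trans q∣e (n∣m*n p)))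
                        (suc k ∣? p * e) (suc k ∣? e)))
        (sym (ℕₚ.+-identityʳ _))

    μ-*-∤ : ¬ p ∣ e → μ (p * e) ≡ ℤ.- μ e
    μ-*-∤ p∤e rewrite μ-unfold (p * e) | μ-unfold e | primeSquareDivisorCount-∤ p∤e | primeDivisorCount-∤ p∤e
      with primeSquareDivisorCount e ≡ᵇ 0
    ... | true  = ℤₚ.-1*i≡-i _
    ... | false = refl

  μ-prime-* : ∀ {p'} e → Prime (suc p') →
              μ (suc p' * suc e) ≡ (if does (suc p' ∣? suc e) then 0ℤ else ℤ.- μ (suc e))
  μ-prime-* {p'} e p-prime = by-cases (suc p' ∣? suc e)
    where
    by-cases : (p∣?e : Dec (suc p' ∣ suc e)) → μ (suc p' * suc e) ≡ (if does p∣?e then 0ℤ else ℤ.- μ (suc e))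
    by-cases (yes p∣e) = μ-*-∣ p-prime (suc e) p∣e
    by-cases (no p∤e)  = μ-*-∤ p-prime (suc e) p∤e

  μ∣ : ℕ → ℕ → ℤ
  μ∣ g k = if does (suc k ∣? g) then μ (suc k) else 0ℤ

  -- The divisors p·e of m·p with p ∤ e contribute μ(p·e) = −μ(e) and cancel the divisors of m·p
  -- prime to p, which are exactly the divisors e of m with p ∤ e; the other multiples of p have μ = 0.
  module _ {p' m} (p-prime : Prime (suc p')) .{{_ : NonZero m}} where

    private
      p = suc p'

      ν : ℕ → ℤ
      ν k = if does (suc k ∣? m) then (if does (p ∣? suc k) then 0ℤ else μ (suc k)) else 0ℤ

      ∣m*p⇔∣m : ∀ {d} → ¬ p ∣ d → d ∣ m * p ⇔ d ∣ m
      ∣m*p⇔∣m {d} p∤d = mk⇔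
        (λ d∣mp → coprime-divisor (coprime-sym (prime∤⇒coprime p-prime p∤d)) (subst (d ∣_) (ℕₚ.*-comm m p) d∣mp))
        (λ d∣m → ∣-trans d∣m (m∣m*n p))

      ∑-μ∣-p∤ : ℤΣ.∑[ k < m * p ] (if does (p ∣? suc k) then 0ℤ else μ∣ (m * p) k) ≡ ℤΣ.∑ m ν
      ∑-μ∣-p∤ = trans (ℤΣ.∑-cong (m * p) (λ k _ → term k (p ∣? suc k) (suc k ∣? m * p) (suc k ∣? m)))
                      (ℤΣ.∑-restrict ν (ℕₚ.m≤m*n m p) (λ k m≤k _ →
                        cong (λ b → if b then (if does (p ∣? suc k) then 0ℤ else μ (suc k)) else 0ℤ)
                             (dec-false (suc k ∣? m) (>⇒∤ (s≤s m≤k)))))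
        where
        term : ∀ k (p∣?k : Dec (p ∣ suc k)) (k∣?mp : Dec (suc k ∣ m * p)) (k∣?m : Dec (suc k ∣ m)) →
               (if does p∣?k then 0ℤ else (if does k∣?mp then μ (suc k) else 0ℤ))
               ≡ (if does k∣?m then (if does p∣?k then 0ℤ else μ (suc k)) else 0ℤ)
        term k (yes _)   _     (yes _) = refl
        term k (yes _)   _     (no _)  = refl
        term k (no p∤k) k∣?mp k∣?m     =
          cong (λ b → if b then μ (suc k) else 0ℤ) (does-⇔ (∣m*p⇔∣m p∤k) k∣?mp k∣?m)

      ∑-μ∣-p∣ : ℤΣ.∑[ k < m * p ] (if does (p ∣? suc k) then μ∣ (m * p) k else 0ℤ) ≡ -1ℤ ℤ.* ℤΣ.∑ m ν
      ∑-μ∣-p∣ = begin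
        ℤΣ.∑[ k < m * p ] (if does (p ∣? suc k) then μ∣ (m * p) k else 0ℤ) ≡⟨ ℤΣ.∑-multiples m p' (μ∣ (m * p)) ⟩
        ℤΣ.∑[ e < m ] μ∣ (m * p) (e * p + p')                              ≡⟨ ℤΣ.∑-cong m (λ e _ → term e) ⟩
        ℤΣ.∑[ e < m ] (-1ℤ ℤ.* ν e)                                        ≡⟨ ℤΣ.∑-distribˡ m -1ℤ ν ⟩
        -1ℤ ℤ.* ℤΣ.∑ m ν                                                   ∎
        where
        open ≡-Reasoning
        block-end : ∀ e → suc (e * p + p') ≡ p * suc e
        block-end e = trans (cong suc (ℕₚ.+-comm (e * p) p')) (ℕₚ.*-comm (suc e) p)
        sign : ∀ e (p∣?e : Dec (p ∣ suc e)) (e∣?m : Dec (suc e ∣ m)) →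
               (if does e∣?m then (if does p∣?e then 0ℤ else ℤ.- μ (suc e)) else 0ℤ)
               ≡ -1ℤ ℤ.* (if does e∣?m then (if does p∣?e then 0ℤ else μ (suc e)) else 0ℤ)
        sign e (yes _) (yes _) = refl
        sign e (no _)  (yes _) = sym (ℤₚ.-1*i≡-i (μ (suc e)))
        sign e _       (no _)  = refl
        term : ∀ e → μ∣ (m * p) (e * p + p') ≡ -1ℤ ℤ.* ν e
        term e = begin
          μ∣ (m * p) (e * p + p')
            ≡⟨ cong (λ d → if does (d ∣? m * p) then μ d else 0ℤ) (block-end e) ⟩
          (if does (p * suc e ∣? m * p) then μ (p * suc e) else 0ℤ)
            ≡⟨ cong₂ (λ b x → if b then x else 0ℤ)
                 (does-⇔ (mk⇔ (λ pe∣mp → *-cancelˡ-∣ p (subst (p * suc e ∣_) (ℕₚ.*-comm m p) pe∣mp))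
                              (λ e∣m → subst (p * suc e ∣_) (ℕₚ.*-comm p m) (*-monoʳ-∣ p e∣m)))
                         (p * suc e ∣? m * p) (suc e ∣? m))
                 (μ-prime-* e p-prime) ⟩
          (if does (suc e ∣? m) then (if does (p ∣? suc e) then 0ℤ else ℤ.- μ (suc e)) else 0ℤ)
            ≡⟨ sign e (p ∣? suc e) (suc e ∣? m) ⟩
          -1ℤ ℤ.* ν e ∎

    ∑-μ∣-multiple : ℤΣ.∑ (m * p) (μ∣ (m * p)) ≡ 0ℤ
    ∑-μ∣-multiple = begin
      ℤΣ.∑ (m * p) (μ∣ (m * p))
        ≡⟨ ℤΣ.∑-cong (m * p) (λ k _ → split (does (p ∣? suc k)) (μ∣ (m * p) k)) ⟩
      ℤΣ.∑[ k < m * p ] (on k ℤ.+ off k)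
        ≡⟨ ℤΣ.∑-distrib-+ (m * p) on off ⟩
      ℤΣ.∑ (m * p) on ℤ.+ ℤΣ.∑ (m * p) off
        ≡⟨ cong₂ ℤ._+_ ∑-μ∣-p∣ ∑-μ∣-p∤ ⟩
      -1ℤ ℤ.* ℤΣ.∑ m ν ℤ.+ ℤΣ.∑ m ν
        ≡⟨ cong (ℤ._+ ℤΣ.∑ m ν) (ℤₚ.-1*i≡-i (ℤΣ.∑ m ν)) ⟩
      ℤ.- ℤΣ.∑ m ν ℤ.+ ℤΣ.∑ m ν
        ≡⟨ ℤₚ.+-inverseˡ (ℤΣ.∑ m ν) ⟩
      0ℤ ∎
      where
      open ≡-Reasoning
      on off : ℕ → ℤ
      on  k = if does (p ∣? suc k) then μ∣ (m * p) k else 0ℤ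
      off k = if does (p ∣? suc k) then 0ℤ else μ∣ (m * p) k
      split : ∀ b x → x ≡ (if b then x else 0ℤ) ℤ.+ (if b then 0ℤ else x)
      split true  x = sym (ℤₚ.+-identityʳ x)
      split false x = sym (ℤₚ.+-identityˡ x)

  prime-divisor : ∀ n → 2 ≤ n → ∃[ p ] Prime p × p ∣ n
  prime-divisor 1 (s≤s ())
  prime-divisor n@(suc (suc _)) _ with factorise n
  ... | record { factors = [] ; isFactorisation = () }
  ... | record { factors = p ∷ ps ; isFactorisation = Πps≡n ; factorsPrime = p-prime ∷ _ } =
    p , p-prime , subst (p ∣_) (sym Πps≡n) (m∣m*n (product ps))

  ∑-μ∣ : ∀ g .{{_ : NonZero g}} → ℤΣ.∑ g (μ∣ g) ≡ ℤΣ.𝟙 (g ≡ᵇ 1)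
  ∑-μ∣ 1 = refl
  ∑-μ∣ g@(suc (suc _)) with prime-divisor g (s≤s (s≤s z≤n))
  ... | zero   , 0-prime , _                   = ⊥-elim (ℕₚ.<⇒≱ (prime>1 0-prime) z≤n)
  ... | suc p' , p-prime , divides zero ()
  ... | suc p' , p-prime , divides m@(suc _) g≡mp =
    subst (λ x → ℤΣ.∑ x (μ∣ x) ≡ 0ℤ) (sym g≡mp) (∑-μ∣-multiple {m = m} p-prime)

  ∑-μ∣-≤ : ∀ {g N} .{{_ : NonZero g}} → g ≤ N → ℤΣ.∑ N (μ∣ g) ≡ ℤΣ.𝟙 (g ≡ᵇ 1)
  ∑-μ∣-≤ {g} g≤N = trans
    (ℤΣ.∑-restrict (μ∣ g) g≤N (λ k g≤k _ →
      cong (λ b → if b then μ (suc k) else 0ℤ) (dec-false (suc k ∣? g) (>⇒∤ (s≤s g≤k)))))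
    (∑-μ∣ g)

module Legendre where

  open import Data.Bool using (true; false; if_then_else_)
  open import Data.Integer as ℤ using (ℤ; +_; 0ℤ)
  import Data.Integer.Properties as ℤₚ
  open import Data.Nat as ℕ using (ℕ; zero; suc; _+_; _*_; _<_; _≟_; NonZero)
  import Data.Nat.Properties as ℕₚ
  open import Data.Nat.DivMod using (_/_; _%_; m≡m%n+[m/n]*n; m%n<n)
  open import Data.Nat.Divisibility using (_∣_; _∣?_; ∣-trans)
  open import Data.Nat.GCD using (gcd; gcd[m,n]∣m; gcd[m,n]∣n; gcd-greatest; gcd[m,n]≤n; gcd[m,n]≢0)
  open import Data.Sum using (inj₁)
  open import Data.Empty using (⊥-elim)
  open import Relation.Binary.PropositionalEquality
  open import Relation.Nullary using (Dec; does; yes; no)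
  open import Relation.Nullary.Decidable using (dec-false)
  open FiniteSums
  open FareyCount
  open Möbius

  open ℕΣ using (𝟙)

  ∑-pos : ∀ n (f : ℕ → ℕ) → + (ℕΣ.∑ n f) ≡ ℤΣ.∑[ k < n ] (+ f k)
  ∑-pos zero    f = refl
  ∑-pos (suc n) f = trans (ℤₚ.pos-+ (ℕΣ.∑ n f) (f n)) (cong (ℤ._+ + f n) (∑-pos n f))

  ∑-const-1 : ∀ n → ℕΣ.∑[ _ < n ] 1 ≡ n
  ∑-const-1 zero    = refl
  ∑-const-1 (suc n) = trans (cong (_+ 1) (∑-const-1 n)) (ℕₚ.+-comm n 1)

  multiplesCount : ∀ N d' → ℕΣ.∑[ b < N ] 𝟙 (does (suc d' ∣? suc b)) ≡ N / suc d'
  multiplesCount N d' = begin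
    ℕΣ.∑ N m                               ≡⟨ cong (λ x → ℕΣ.∑ x m) (trans (m≡m%n+[m/n]*n N d) (ℕₚ.+-comm r (q * d))) ⟩
    ℕΣ.∑ (q * d + r) m                     ≡⟨ ℕΣ.∑-split (q * d) r m ⟩
    ℕΣ.∑ (q * d) m + ℕΣ.∑[ j < r ] m (q * d + j) ≡⟨ cong₂ _+_ (ℕΣ.∑-multiples q d' (λ _ → 1)) (ℕΣ.∑-zero r none) ⟩
    ℕΣ.∑[ _ < q ] 1 + 0                    ≡⟨ trans (ℕₚ.+-identityʳ _) (∑-const-1 q) ⟩
    q                                      ∎
    where
    open ≡-Reasoning
    d = suc d'
    q = N / d
    r = N % d
    m = λ b → 𝟙 (does (d ∣? suc b))
    none : ∀ j → j < r → m (q * d + j) ≡ 0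
    none j j<r = cong 𝟙 (dec-false (d ∣? _) λ d∣ →
      ℕₚ.<-irrefl (∣-within-block {e = q} (ℕₚ.<-trans j<r (m%n<n N d)) d∣) (ℕₚ.≤-<-trans j<r (m%n<n N d)))

  coprime-indicator : ∀ h .{{_ : NonZero h}} b →
    ℤΣ.𝟙 (does (gcd (suc b) h ≟ 1)) ≡ ℤΣ.∑[ k < h ] (μ∣ h k ℤ.* + 𝟙 (does (suc k ∣? suc b)))
  coprime-indicator h b = sym (trans
    (ℤΣ.∑-cong h (λ k _ → term k (suc k ∣? h) (suc k ∣? suc b) (suc k ∣? g)))
    (∑-μ∣-≤ {{g≢0}} (gcd[m,n]≤n (suc b) h)))
    where
    g = gcd (suc b) h
    g≢0 : NonZero g
    g≢0 = ℕ.≢-nonZero (gcd[m,n]≢0 (suc b) h (inj₁ (λ ())))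
    term : ∀ k (k∣?h : Dec (suc k ∣ h)) (k∣?b : Dec (suc k ∣ suc b)) (k∣?g : Dec (suc k ∣ g)) →
           (if does k∣?h then μ (suc k) else 0ℤ) ℤ.* + 𝟙 (does k∣?b) ≡ (if does k∣?g then μ (suc k) else 0ℤ)
    term k (yes _)   (yes _)   (yes _)   = ℤₚ.*-identityʳ (μ (suc k))
    term k (yes k∣h) (yes k∣b) (no k∤g)  = ⊥-elim (k∤g (gcd-greatest k∣b k∣h))
    term k _         (no k∤b)  (yes k∣g) = ⊥-elim (k∤b (∣-trans k∣g (gcd[m,n]∣m (suc b) h)))
    term k (yes _)   (no _)    (no _)    = ℤₚ.*-zeroʳ (μ (suc k))
    term k (no k∤h)  _         (yes k∣g) = ⊥-elim (k∤h (∣-trans k∣g (gcd[m,n]∣n (suc b) h)))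
    term k (no _)    _         (no _)    = refl

  pos-𝟙 : ∀ b → + 𝟙 b ≡ ℤΣ.𝟙 b
  pos-𝟙 true  = refl
  pos-𝟙 false = refl

  coprimeCount-Möbius : ∀ h .{{_ : NonZero h}} N →
    + coprimeCount h N ≡ ℤΣ.∑[ k < h ] (μ∣ h k ℤ.* + (N / suc k))
  coprimeCount-Möbius h N = begin
    + coprimeCount h N
      ≡⟨ ∑-pos N _ ⟩
    ℤΣ.∑[ b < N ] (+ 𝟙 (does (gcd (suc b) h ≟ 1)))
      ≡⟨ ℤΣ.∑-cong N (λ b _ → trans (pos-𝟙 _) (coprime-indicator h b)) ⟩
    ℤΣ.∑[ b < N ] ℤΣ.∑[ k < h ] (μ∣ h k ℤ.* + 𝟙 (does (suc k ∣? suc b)))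
      ≡⟨ ℤΣ.∑-comm N h _ ⟩
    ℤΣ.∑[ k < h ] ℤΣ.∑[ b < N ] (μ∣ h k ℤ.* + 𝟙 (does (suc k ∣? suc b)))
      ≡⟨ ℤΣ.∑-cong h (λ k _ → multiples k) ⟩
    ℤΣ.∑[ k < h ] (μ∣ h k ℤ.* + (N / suc k)) ∎
    where
    open ≡-Reasoning
    multiples : ∀ k → ℤΣ.∑[ b < N ] (μ∣ h k ℤ.* + 𝟙 (does (suc k ∣? suc b))) ≡ μ∣ h k ℤ.* + (N / suc k)
    multiples k = begin
      ℤΣ.∑[ b < N ] (μ∣ h k ℤ.* + 𝟙 (does (suc k ∣? suc b))) ≡⟨ ℤΣ.∑-distribˡ N (μ∣ h k) _ ⟩
      μ∣ h k ℤ.* ℤΣ.∑[ b < N ] (+ 𝟙 (does (suc k ∣? suc b)))  ≡⟨ cong (μ∣ h k ℤ.*_) (sym (∑-pos N _)) ⟩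
      μ∣ h k ℤ.* + ℕΣ.∑[ b < N ] 𝟙 (does (suc k ∣? suc b))    ≡⟨ cong (λ x → μ∣ h k ℤ.* + x) (multiplesCount N k) ⟩
      μ∣ h k ℤ.* + (N / suc k) ∎

module Rationals where

  open import Data.Integer as ℤ using (ℤ; +_; -[1+_])
  import Data.Integer.Properties as ℤₚ
  open import Data.Nat as ℕ using (ℕ; zero; suc)
  import Data.Nat.Properties as ℕₚ
  import Data.Nat.DivMod as ℕ
  open import Data.Rational as ℚ using (ℚ; mkℚ; _/_; _+_; _*_; _-_; toℚᵘ; ↥_; ↧_)
  import Data.Rational.Properties as ℚₚ
  open import Data.Rational.Unnormalised as ℚᵘ using (mkℚᵘ; *≡*)
  import Data.Rational.Unnormalised.Properties as ℚᵘₚ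
  open import Relation.Binary.PropositionalEquality
  open FiniteSums

  ιq : ℤ → ℚ
  ιq i = i / 1

  /-cross : ∀ i j a b → i ℤ.* + suc b ≡ j ℤ.* + suc a → i / suc a ≡ j / suc b
  /-cross i j a b eq = ℚₚ.fromℚᵘ-cong {mkℚᵘ i a} {mkℚᵘ j b} (*≡* eq)

  toℚᵘ-/ : ∀ i a → toℚᵘ (i / suc a) ℚᵘ.≃ mkℚᵘ i a
  toℚᵘ-/ i a = ℚₚ.toℚᵘ-fromℚᵘ (mkℚᵘ i a)

  /-+ : ∀ i j a b → i / suc a + j / suc b ≡ (i ℤ.* + suc b ℤ.+ j ℤ.* + suc a) / (suc a ℕ.* suc b)
  /-+ i j a b = ℚₚ.toℚᵘ-injective (ℚᵘₚ.≃-trans (ℚₚ.toℚᵘ-homo-+ (i / suc a) (j / suc b))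
    (ℚᵘₚ.≃-trans (ℚᵘₚ.+-cong (toℚᵘ-/ i a) (toℚᵘ-/ j b)) (ℚᵘₚ.≃-sym (toℚᵘ-/ _ _))))

  /-* : ∀ i j a b → (i / suc a) * (j / suc b) ≡ (i ℤ.* j) / (suc a ℕ.* suc b)
  /-* i j a b = ℚₚ.toℚᵘ-injective (ℚᵘₚ.≃-trans (ℚₚ.toℚᵘ-homo-* (i / suc a) (j / suc b))
    (ℚᵘₚ.≃-trans (ℚᵘₚ.*-cong (toℚᵘ-/ i a) (toℚᵘ-/ j b)) (ℚᵘₚ.≃-sym (toℚᵘ-/ _ _))))

  ιq-+ : ∀ i j → ιq (i ℤ.+ j) ≡ ιq i + ιq j
  ιq-+ i j = sym (trans (/-+ i j 0 0) (cong₂ (λ x y → (x ℤ.+ y) / 1) (ℤₚ.*-identityʳ i) (ℤₚ.*-identityʳ j)))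

  ιq-* : ∀ i j → ιq (i ℤ.* j) ≡ ιq i * ιq j
  ιq-* i j = sym (/-* i j 0 0)

  /≡ιq*1/ : ∀ i h' → i / suc h' ≡ ιq i * (+ 1 / suc h')
  /≡ιq*1/ i h' = trans (/-cross i (i ℤ.* + 1) h' (h' ℕ.+ 0) cross) (sym (/-* i (+ 1) 0 h'))
    where
    cross : i ℤ.* + suc (h' ℕ.+ 0) ≡ (i ℤ.* + 1) ℤ.* + suc h'
    cross rewrite ℕₚ.+-identityʳ h' | ℤₚ.*-identityʳ i = refl

  floor-scaled : ∀ (p : ℚ) n d' g → ↥ p ℤ.* + g ≡ + n → ↧ p ℤ.* + g ≡ + suc d' → ℚ.floor p ≡ + (n ℕ./ suc d')
  floor-scaled (mkℚ (+ a) b _) n d' zero _ ↧p*0≡d with trans (sym (ℤₚ.*-zeroʳ (+ suc b))) ↧p*0≡d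
  ... | ()
  floor-scaled (mkℚ (+ a) b _) n d' (suc g') ↥p*g≡n ↧p*g≡d =
    trans (ℤₚ.*-identityˡ _) (cong +_ (sym (cancel (ℤₚ.+-injective (trans (ℤₚ.pos-* a (suc g')) ↥p*g≡n))
                                                 (ℤₚ.+-injective (trans (ℤₚ.pos-* (suc b) (suc g')) ↧p*g≡d)))))
    where
    cancel : ∀ {D} .{{_ : ℕ.NonZero D}} → a ℕ.* suc g' ≡ n → suc b ℕ.* suc g' ≡ D → n ℕ./ D ≡ a ℕ./ suc b
    cancel refl refl = ℕ.m*n/o*n≡m/o a (suc g') (suc b)
  floor-scaled (mkℚ -[1+ a ] b _) n d' zero _ ↧p*0≡d with trans (sym (ℤₚ.*-zeroʳ (+ suc b))) ↧p*0≡d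
  ... | ()
  floor-scaled (mkℚ -[1+ a ] b _) n d' (suc g') () _

  floor-/ : ∀ n d' → ℚ.floor (+ n / suc d') ≡ + (n ℕ./ suc d')
  floor-/ n d' = floor-scaled (+ n / suc d') n d' _ (ℚₚ.↥-/ (+ n) (suc d')) (ℚₚ.↧-/ (+ n) (suc d'))

  ιq-neg : ∀ i → ιq (ℤ.- i) ≡ ℚ.- ιq i
  ιq-neg i = ℚₚ.toℚᵘ-injective (ℚᵘₚ.≃-trans (toℚᵘ-/ (ℤ.- i) 0)
    (ℚᵘₚ.≃-sym (ℚᵘₚ.≃-trans (ℚₚ.toℚᵘ-homo‿- (i / 1)) (ℚᵘₚ.-‿cong (toℚᵘ-/ i 0)))))

  n*1/n≡1 : ∀ n' → ιq (+ suc n') * (+ 1 / suc n') ≡ ℚ.1ℚ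
  n*1/n≡1 n' = trans (sym (/≡ιq*1/ (+ suc n') n')) (/-cross (+ suc n') (+ 1) n' 0 (ℤₚ.*-comm (+ suc n') (+ 1)))

  ιq-∑ : ∀ n (f : ℕ → ℤ) → ιq (ℤΣ.∑ n f) ≡ ℚΣ.∑[ k < n ] ιq (f k)
  ιq-∑ zero    f = refl
  ιq-∑ (suc n) f = trans (ιq-+ (ℤΣ.∑ n f) (f n)) (cong (_+ ιq (f n)) (ιq-∑ n f))

open import Data.Bool using (true; false; if_then_else_)
open import Data.Integer as ℤ using (ℤ; +_; 0ℤ)
import Data.Integer.Properties as ℤₚ
import Data.Integer.Solver as ℤSolver
open import Data.List using (upTo)
open import Data.Nat as ℕ using (ℕ; suc; _<_; _≡ᵇ_; >-nonZero)
import Data.Nat.Properties as ℕₚ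
open import Data.Nat.DivMod using (_/_; m*[n/m]≡n)
open import Data.Nat.Divisibility using (_∣_; _∣?_)
open import Data.Rational as ℚ using (ℚ; _+_; _*_; _-_; 0ℚ; 1ℚ)
import Data.Rational.Properties as ℚₚ
import Data.Rational.Solver as ℚSolver
open import Relation.Binary.PropositionalEquality
open import Relation.Nullary using (Dec; does; yes; no)
open import Function using (_∘_)

open FiniteSums
open FareyCount
open Möbius
open Legendre
open Rationals

open ℕΣ using (𝟙)

module _ (h' n : ℕ) where

  private
    h = suc h'
    u = + 1 ℚ./ h

  -- Over the common denominator h: n/d = n·(h/d)/h and ⌊n/d⌋ = h·⌊n/d⌋/h.
  frac-term : ∀ k (k∣?h : Dec (suc k ∣ h)) →
    (if does k∣?h then ιq (μ (suc k)) * frac (+ n ℚ./ suc k) else 0ℚ)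
    ≡ ιq ((if does k∣?h then μ (suc k) else 0ℤ) ℤ.* (+ n ℤ.* + (h / suc k) ℤ.- + h ℤ.* + (n / suc k))) * u
  frac-term k (no _)    = sym (ℚₚ.*-zeroˡ u)
  frac-term k (yes k∣h) = begin
    ιq m * (+ n ℚ./ d - ιq (ℚ.floor (+ n ℚ./ d)))    ≡⟨ cong (λ z → ιq m * (+ n ℚ./ d - ιq z)) (floor-/ n k) ⟩
    ιq m * (+ n ℚ./ d - ιq (+ q))                     ≡⟨ cong₂ (λ x y → ιq m * (x - y)) n/d≡ q≡ ⟩
    ιq m * (ιq A * u - ιq B * u)                      ≡⟨ solve 4 (λ M A B U → M :* (A :* U :- B :* U) := (M :* (A :- B)) :* U)
                                                                 refl (ιq m) (ιq A) (ιq B) u ⟩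
    (ιq m * (ιq A - ιq B)) * u                        ≡⟨ cong (_* u) (sym ιq-hom) ⟩
    ιq (m ℤ.* (A ℤ.- B)) * u                          ∎
    where
    open ≡-Reasoning
    open ℚSolver.+-*-Solver
    module ℤS = ℤSolver.+-*-Solver
    d = suc k
    m = μ d
    r = h / d
    q = n / d
    A = + n ℤ.* + r
    B = + h ℤ.* + q
    d*r≡h : d ℕ.* r ≡ h
    d*r≡h = m*[n/m]≡n k∣h
    n/d≡ : + n ℚ./ d ≡ ιq A * u
    n/d≡ = trans (/-cross (+ n) A k h' (begin
      + n ℤ.* + h               ≡⟨ cong (λ x → + n ℤ.* + x) (sym d*r≡h) ⟩
      + n ℤ.* + (d ℕ.* r)       ≡⟨ cong (+ n ℤ.*_) (ℤₚ.pos-* d r) ⟩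
      + n ℤ.* (+ d ℤ.* + r)     ≡⟨ ℤS.solve 3 (λ N D R → N ℤS.:* (D ℤS.:* R) ℤS.:= (N ℤS.:* R) ℤS.:* D) refl (+ n) (+ d) (+ r) ⟩
      A ℤ.* + d                 ∎)) (/≡ιq*1/ A h')
    q≡ : ιq (+ q) ≡ ιq B * u
    q≡ = trans (/-cross (+ q) B 0 h' (ℤS.solve 2 (λ Q H → Q ℤS.:* H ℤS.:= (H ℤS.:* Q) ℤS.:* ℤS.con (+ 1)) refl (+ q) (+ h)))
      (/≡ιq*1/ B h')
    ιq-hom : ιq (m ℤ.* (A ℤ.- B)) ≡ ιq m * (ιq A - ιq B)
    ιq-hom = trans (ιq-* m (A ℤ.- B)) (cong (ιq m *_) (trans (ιq-+ A (ℤ.- B)) (cong (λ x → ιq A + x) (ιq-neg B))))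

  divisorSum≡ : divisorSum h n ≡
    ιq (ℤΣ.∑[ k < h ] (μ∣ h k ℤ.* (+ n ℤ.* + (h / suc k) ℤ.- + h ℤ.* + (n / suc k)))) * u
  divisorSum≡ = begin
    divisorSum h n
      ≡⟨ ℚΣ.sumOf-filter (λ k → suc k ∣? h) T (upTo h) ⟩
    ℚΣ.sumOf (λ k → if does (suc k ∣? h) then T k else 0ℚ) (upTo h)
      ≡⟨ ℚΣ.sumOf-applyUpTo _ (λ k → k) h ⟩
    ℚΣ.∑[ k < h ] (if does (suc k ∣? h) then T k else 0ℚ)
      ≡⟨ ℚΣ.∑-cong h (λ k _ → frac-term k (suc k ∣? h)) ⟩
    ℚΣ.∑[ k < h ] (ιq (W k) * u)
      ≡⟨ ℚΣ.∑-distribʳ h u (ιq ∘ W) ⟩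
    (ℚΣ.∑[ k < h ] ιq (W k)) * u
      ≡⟨ cong (_* u) (sym (ιq-∑ h W)) ⟩
    ιq (ℤΣ.∑ h W) * u ∎
    where
    open ≡-Reasoning
    T : ℕ → ℚ
    T k = ιq (μ (suc k)) * frac (+ n ℚ./ suc k)
    W : ℕ → ℤ
    W k = μ∣ h k ℤ.* (+ n ℤ.* + (h / suc k) ℤ.- + h ℤ.* + (n / suc k))

  ∑-μ∣-numerator : ℤΣ.∑[ k < h ] (μ∣ h k ℤ.* (+ n ℤ.* + (h / suc k) ℤ.- + h ℤ.* + (n / suc k)))
                   ≡ + n ℤ.* + φ h ℤ.+ ℤ.- + h ℤ.* + coprimeCount h n
  ∑-μ∣-numerator = begin
    ℤΣ.∑[ k < h ] (μ∣ h k ℤ.* (+ n ℤ.* + (h / suc k) ℤ.- + h ℤ.* + (n / suc k)))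
      ≡⟨ ℤΣ.∑-cong h (λ k _ → expand (μ∣ h k) (+ (h / suc k)) (+ (n / suc k))) ⟩
    ℤΣ.∑[ k < h ] (+ n ℤ.* (μ∣ h k ℤ.* + (h / suc k)) ℤ.+ ℤ.- + h ℤ.* (μ∣ h k ℤ.* + (n / suc k)))
      ≡⟨ ℤΣ.∑-distrib-+ h _ _ ⟩
    ℤΣ.∑[ k < h ] (+ n ℤ.* (μ∣ h k ℤ.* + (h / suc k))) ℤ.+ ℤΣ.∑[ k < h ] (ℤ.- + h ℤ.* (μ∣ h k ℤ.* + (n / suc k)))
      ≡⟨ cong₂ ℤ._+_ (ℤΣ.∑-distribˡ h (+ n) _) (ℤΣ.∑-distribˡ h (ℤ.- + h) _) ⟩
    + n ℤ.* ℤΣ.∑[ k < h ] (μ∣ h k ℤ.* + (h / suc k)) ℤ.+ ℤ.- + h ℤ.* ℤΣ.∑[ k < h ] (μ∣ h k ℤ.* + (n / suc k))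
      ≡⟨ cong₂ (λ x y → + n ℤ.* x ℤ.+ ℤ.- + h ℤ.* y)
           (trans (sym (coprimeCount-Möbius h h)) (cong +_ (sym (φ≡coprimeCount h))))
           (sym (coprimeCount-Möbius h n)) ⟩
    + n ℤ.* + φ h ℤ.+ ℤ.- + h ℤ.* + coprimeCount h n ∎
    where
    open ≡-Reasoning
    open ℤSolver.+-*-Solver
    expand : ∀ a x y → a ℤ.* (+ n ℤ.* x ℤ.- + h ℤ.* y) ≡ + n ℤ.* (a ℤ.* x) ℤ.+ ℤ.- + h ℤ.* (a ℤ.* y)
    expand a x y = solve 5 (λ A X Y N H → A :* (N :* X :- H :* Y) := N :* (A :* X) :+ (:- H) :* (A :* Y)) refl a x y (+ n) (+ h)

  divisorSum-closed : divisorSum h n ≡ (ℕ→ℚ n * ℕ→ℚ (φ h) + ℚ.- ℕ→ℚ h * ℕ→ℚ (coprimeCount h n)) * u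
  divisorSum-closed = begin
    divisorSum h n                                                   ≡⟨ divisorSum≡ ⟩
    ιq (ℤΣ.∑[ k < h ] (μ∣ h k ℤ.* (+ n ℤ.* + (h / suc k) ℤ.- + h ℤ.* + (n / suc k)))) * u
                                                                     ≡⟨ cong (λ z → ιq z * u) ∑-μ∣-numerator ⟩
    ιq (+ n ℤ.* + φ h ℤ.+ ℤ.- + h ℤ.* + coprimeCount h n) * u        ≡⟨ cong (_* u) ιq-hom ⟩
    (ℕ→ℚ n * ℕ→ℚ (φ h) + ℚ.- ℕ→ℚ h * ℕ→ℚ (coprimeCount h n)) * u    ∎
    where
    open ≡-Reasoning
    ιq-hom : ιq (+ n ℤ.* + φ h ℤ.+ ℤ.- + h ℤ.* + coprimeCount h n)
             ≡ ℕ→ℚ n * ℕ→ℚ (φ h) + ℚ.- ℕ→ℚ h * ℕ→ℚ (coprimeCount h n)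
    ιq-hom = trans (ιq-+ (+ n ℤ.* + φ h) (ℤ.- + h ℤ.* + coprimeCount h n))
      (cong₂ _+_ (ιq-* (+ n) (+ φ h))
                 (trans (ιq-* (ℤ.- + h) (+ coprimeCount h n)) (cong (_* ℕ→ℚ (coprimeCount h n)) (ιq-neg (+ h)))))

ℕ→ℚ-+ : ∀ a b → ℕ→ℚ (a ℕ.+ b) ≡ ℕ→ℚ a + ℕ→ℚ b
ℕ→ℚ-+ a b = trans (cong ιq (ℤₚ.pos-+ a b)) (ιq-+ (+ a) (+ b))

ℕ→ℚ-𝟙 : ∀ b → ℕ→ℚ (𝟙 b) ≡ (if b then 1ℚ else 0ℚ)
ℕ→ℚ-𝟙 true  = refl
ℕ→ℚ-𝟙 false = refl

rearrange : ∀ X P C D N H U → H * U ≡ 1ℚ → X + P ≡ C + D →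
            X ≡ N * (P * U) - P - (N * P + ℚ.- H * C) * U + D
rearrange X P C D N H U H*U≡1 X+P≡C+D = begin
  X                                        ≡⟨ solve 2 (λ X P → X := (X :+ P) :- P) refl X P ⟩
  (X + P) - P                              ≡⟨ cong (_- P) X+P≡C+D ⟩
  (C + D) - P                              ≡⟨ cong (λ z → z + D - P) (sym (ℚₚ.*-identityˡ C)) ⟩
  (1ℚ * C + D) - P                         ≡⟨ cong (λ z → (z * C + D) - P) (sym H*U≡1) ⟩
  ((H * U) * C + D) - P                    ≡⟨ solve 6 (λ C D P N H U →
                                                  (H :* U) :* C :+ D :- P
                                                  := N :* (P :* U) :- P :- (N :* P :+ (:- H) :* C) :* U :+ D)
                                                refl C D P N H U ⟩
  N * (P * U) - P - (N * P + ℚ.- H * C) * U + D ∎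
  where
  open ≡-Reasoning
  open ℚSolver.+-*-Solver

theorem1 : (h n : ℕ) (0<h : 0 < h) → h < n →
    ℕ→ℚ (𝒩 n h) ≡
    ((ℕ→ℚ n * ℚ._/_ (+ φ h) h {{>-nonZero 0<h}}) - ℕ→ℚ (φ h)) - divisorSum h n + δ₁ h
theorem1 h@(suc h') n _ h<n = begin
  ℕ→ℚ (𝒩 n h)                                            ≡⟨ rearrange _ P C D N (ℕ→ℚ h) u (n*1/n≡1 h') count ⟩
  N * (P * u) - P - (N * P + ℚ.- ℕ→ℚ h * C) * u + D      ≡⟨ cong₂ (λ x y → N * x - P - y + D)
                                                              (sym (/≡ιq*1/ (+ φ h) h')) (sym (divisorSum-closed h' n)) ⟩
  N * (+ φ h ℚ./ h) - P - divisorSum h n + D              ≡⟨ cong (λ z → N * (+ φ h ℚ./ h) - P - divisorSum h n + z)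
                                                              (ℕ→ℚ-𝟙 (h ≡ᵇ 1)) ⟩
  N * (+ φ h ℚ./ h) - P - divisorSum h n + δ₁ h           ∎
  where
  open ≡-Reasoning
  u = + 1 ℚ./ h
  N = ℕ→ℚ n
  P = ℕ→ℚ (φ h)
  C = ℕ→ℚ (coprimeCount h n)
  D = ℕ→ℚ (𝟙 (h ≡ᵇ 1))
  count : ℕ→ℚ (𝒩 n h) + P ≡ C + D
  count = begin
    ℕ→ℚ (𝒩 n h) + P                      ≡⟨ ℕ→ℚ-+ (𝒩 n h) (φ h) ⟨
    ℕ→ℚ (𝒩 n h ℕ.+ φ h)                   ≡⟨ cong ℕ→ℚ (𝒩+φ (ℕₚ.<⇒≤ h<n)) ⟩
    ℕ→ℚ (coprimeCount h n ℕ.+ 𝟙 (h ≡ᵇ 1)) ≡⟨ ℕ→ℚ-+ (coprimeCount h n) (𝟙 (h ≡ᵇ 1)) ⟩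
    C + D                                 ∎
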